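{- Let $k\ge 2$ and $\pi\in\mathcal{S}_{\binom{k}{2}}$. Then $\pi\pi^r$ avoids $12\cdots k$ if and only if both of the following hold: (1) for every $1\le i\le k-1$, the $i$th shadow line of $\pi$ contains exactly $k-i$ points; and (2) for every $i$ and $j$, the $j$th point (from the left) on the $i$th shadow line of $\pi$ is the unique point $(m,\pi_m)$ of the graph of $\pi$ such that the longest increasing subsequence of $\pi$ ending at $\pi_m$ has length $i$ and the longest decreasing subsequence of $\pi$ ending at $\pi_m$ has length $j$.
   Context: $\mathcal{S}_n$ is the set of permutations of $[n]$; $\pi^r$ is the reversal of $\pi$ and $\pi\pi^r$ is the concatenation. A word $w$ contains $\rho\in\mathcal{S}_k$ if some subsequence $w_{i_1}\cdots w_{i_k}$ ($i_1<\cdots<i_k$) satisfies $w_{i_a}\le w_{i_b}$ iff $\rho_a\le\rho_b$; otherwise it avoids $\rho$. Shadow lines (Viennot): the graph of $\pi$ is the point set $\{(m,\pi_m):1\le m\le n\}$. The shadow of a point $(x,y)$ is $\{(u,v)\in\mathbb{R}^2: u\ge x, v\ge y\}$. The first shadow line of $\pi$ consists of the points of the graph not lying in the shadow of any other point of the graph (its boundary being that of the union of their shadows); removing these points and repeating on the remaining points gives the second shadow line, and so on. The points of a shadow line are ordered from left to right (equivalently, by decreasing height). -}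

module Defs where

open import Data.Bool using (Bool; true; false; _∧_; not)
open import Data.Nat using (ℕ; zero; suc; _≤ᵇ_; _≡ᵇ_)
import Data.Nat as ℕ
open import Data.Fin using (Fin; toℕ; fromℕ; _<_)
open import Data.Fin.Permutation using (Permutation′; _⟨$⟩ʳ_)
open import Data.Fin.Subset using (Subset; ⊤; ⊥; _─_; _∩_; ∣_∣; _∈_)
open import Data.Vec using (lookup; tabulate)
open import Data.List using (allFin)
open import Data.Bool.ListAction using (any)
open import Data.Vec.Functional using (Vector; _++_; reverse)
open import Data.Product using (Σ; _×_; ∃)
open import Relation.Binary.PropositionalEquality using (_≡_)
open import Function.Bundles using (_⇔_)

-- Permutations of [n] are library permutations of Fin n.
-- The one-line notation π₁ ⋯ πₙ is the word m ↦ π_m ∈ {1,…,n}.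

word : ∀ {n} → Permutation′ n → Vector ℕ n
word π m = suc (toℕ (π ⟨$⟩ʳ m))

concatRev : ∀ {n} → Permutation′ n → Vector ℕ (n ℕ.+ n)
concatRev π = word π ++ reverse (word π)

Contains : ∀ {m k} → Vector ℕ m → Permutation′ k → Set
Contains {m} {k} w ρ =
  Σ (Fin k → Fin m) λ idx →
    (∀ a b → a < b → idx a < idx b) ×
    (∀ a b → (w (idx a) ℕ.≤ w (idx b)) ⇔ (word ρ a ℕ.≤ word ρ b))

Avoids : ∀ {m k} → Vector ℕ m → Permutation′ k → Set
Avoids w ρ = Contains w ρ → Data.Empty.⊥
  where import Data.Empty

-- Shadow lines.  The graph of π is {(m, π_m)}.  The point with index q
-- lies in the shadow of the (other) point with index p iff
-- p ≤ q and π_p ≤ π_q.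

inShadowOfᵇ : ∀ {n} → Permutation′ n → Fin n → Fin n → Bool
inShadowOfᵇ π q p = (toℕ p ≤ᵇ toℕ q) ∧ (word π p ≤ᵇ word π q)

firstLineOf : ∀ {n} → Permutation′ n → Subset n → Subset n
firstLineOf {n} π R = tabulate λ q →
  lookup R q ∧
  not (any (λ p → lookup R p ∧ not (toℕ p ≡ᵇ toℕ q) ∧ inShadowOfᵇ π q p)
           (allFin n))

remaining : ∀ {n} → Permutation′ n → ℕ → Subset n
remaining π zero    = ⊤
remaining π (suc i) = remaining π i ─ firstLineOf π (remaining π i)

-- shadowLine π i  is the i-th shadow line (1-based; index 0 is empty),
-- given as the set of indices m of its points (m, π_m).
shadowLine : ∀ {n} → Permutation′ n → ℕ → Subset n
shadowLine π zero    = ⊥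
shadowLine π (suc i) = firstLineOf π (remaining π i)

leftOf : ∀ {n} → Fin n → Subset n
leftOf {n} m = tabulate λ p → suc (toℕ p) ≤ᵇ toℕ m

IsJthPoint : ∀ {n} → Subset n → ℕ → Fin n → Set
IsJthPoint S j m = m ∈ S × suc ∣ S ∩ leftOf m ∣ ≡ j

IncEndingAt : ∀ {n} → Permutation′ n → Fin n → ℕ → Set
IncEndingAt {n} π m ℓ =
  Σ (Fin (suc ℓ) → Fin n) λ idx →
    (∀ a b → a < b → idx a < idx b) ×
    (∀ a b → a < b → word π (idx a) ℕ.< word π (idx b)) ×
    idx (fromℕ ℓ) ≡ m

DecEndingAt : ∀ {n} → Permutation′ n → Fin n → ℕ → Set
DecEndingAt {n} π m ℓ =
  Σ (Fin (suc ℓ) → Fin n) λ idx →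
    (∀ a b → a < b → idx a < idx b) ×
    (∀ a b → a < b → word π (idx b) ℕ.< word π (idx a)) ×
    idx (fromℕ ℓ) ≡ m

LongestIncEndingAtHasLength : ∀ {n} → Permutation′ n → Fin n → ℕ → Set
LongestIncEndingAtHasLength π m len =
  ∃ λ ℓ → len ≡ suc ℓ × IncEndingAt π m ℓ ×
          (∀ ℓ′ → IncEndingAt π m ℓ′ → ℓ′ ℕ.≤ ℓ)

LongestDecEndingAtHasLength : ∀ {n} → Permutation′ n → Fin n → ℕ → Set
LongestDecEndingAtHasLength π m len =
  ∃ λ ℓ → len ≡ suc ℓ × DecEndingAt π m ℓ ×
          (∀ ℓ′ → DecEndingAt π m ℓ′ → ℓ′ ℕ.≤ ℓ)

-- Let λ(m), δ(m) be the lengths of the longest increasing and decreasing subsequences of π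
-- ending at π_m.  The i-th shadow line is the level set λ = i (Viennot), the map m ↦ (λ, δ)
-- is injective, and along a shadow line δ strictly increases from left to right.  An
-- increasing subsequence of π π^r is an increasing run in π followed by a decreasing run of
-- π read backwards in π^r, so π π^r avoids 12⋯k iff λ(m) + δ(m) ≤ k for every m.
-- Under this bound the δ-values on line i are distinct and at most k − i, so line i has at
-- most k − i points; as these bounds add up to C(k,2) = n, every line is full, and on a
-- full line δ(m) − 1 counts the points to the left of m.  Conversely the two conditions make
-- lines 1, …, k − 1 cover all n points, and then δ(m) − 1, the number of points left of m on
-- its line, is less than k − λ(m).

module Submission where

open import Defs
open import Data.Bool using (Bool; true; false; T; not; _∧_)
open import Data.Bool.Properties using (T-≡; T-∧)
open import Data.Empty using (⊥-elim)
open import Data.Fin as F using (Fin; toℕ; fromℕ; inject₁; opposite; splitAt; zero; suc; _↑ˡ_; _↑ʳ_)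
open import Data.Fin.Permutation using (Permutation′; _⟨$⟩ʳ_; _⟨$⟩ˡ_; inverseˡ; id)
open import Data.Fin.Properties
  using (toℕ-injective; toℕ<n; toℕ-inject₁; toℕ-fromℕ; opposite-prop; opposite-involutive;
         toℕ-↑ˡ; toℕ-↑ʳ; splitAt-↑ˡ; splitAt-↑ʳ; splitAt⁻¹-↑ˡ; splitAt⁻¹-↑ʳ)
  renaming (suc-injective to Fin-suc-injective; 0≢1+n to Fin-0≢1+n)
open import Data.Fin.Subset
open import Data.Fin.Subset.Properties
open import Data.List using (allFin)
open import Data.List.Extrema.Nat using (argmax; argmax-all; f[xs]≤f[argmax])
open import Data.List.Membership.Propositional using (lose)
open import Data.List.Membership.Propositional.Properties using (∈-allFin)
import Data.List.Relation.Unary.All as All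
open import Data.List.Relation.Unary.Any using (satisfied)
open import Data.List.Relation.Unary.Any.Properties using (any⁺; any⁻)
open import Data.Nat using (ℕ; zero; suc; _+_; _∸_; _≤_; _<_; z≤n; s≤s; _≡ᵇ_)
open import Data.Nat.Combinatorics using (_C_; nCk+nC[k+1]≡[n+1]C[k+1]; nC1≡n)
open import Data.Nat.Properties
open import Data.Nat.Solver using (module +-*-Solver)
open import Data.Product using (Σ; _×_; _,_; ∃; proj₁; proj₂)
open import Data.Product.Function.NonDependent.Propositional using (_×-⇔_)
open import Data.Sum using (_⊎_; inj₁; inj₂; [_,_]′)
open import Data.Unit using (tt)
open import Data.Vec using (lookup; tabulate; _∷_; []; here; there)
open import Data.Vec.Functional using (Vector)
open import Data.Vec.Properties using ([]=⇒lookup; lookup⇒[]=; lookup∘tabulate)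
open import Function using (_∘_)
open import Function.Bundles using (_⇔_; mk⇔; Equivalence)
open Equivalence using (to; from)
open import Function.Properties.Equivalence using () renaming (trans to ⇔-trans; sym to ⇔-sym)
open import Relation.Binary using (tri<; tri≈; tri>)
open import Relation.Binary.Definitions using (Transitive)
import Relation.Binary.Definitions as B
open import Relation.Binary.PropositionalEquality
open import Relation.Nullary using (yes; no; ¬_; contradiction)
open import Relation.Nullary.Decidable using (isYes; toWitness; fromWitness; _×-dec_)
open import Relation.Unary using (Pred; Decidable)

private variable n : ℕ

T-not : ∀ {b} → T (not b) ⇔ (¬ T b)
T-not {true}  = mk⇔ (λ ()) (λ ¬t → ¬t tt)
T-not {false} = mk⇔ (λ _ ()) (λ _ → tt)

x∈p⇔T[p[x]] : ∀ {x} {p : Subset n} → x ∈ p ⇔ T (lookup p x)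
x∈p⇔T[p[x]] {x = x} {p} =
  mk⇔ (λ x∈p → from T-≡ ([]=⇒lookup x∈p))
      (λ t → lookup⇒[]= x p (to T-≡ t))

∈-tabulate : ∀ {x} (f : Fin n → Bool) → x ∈ tabulate f ⇔ T (f x)
∈-tabulate {x = x} f = subst (λ b → x ∈ tabulate f ⇔ T b) (lookup∘tabulate f x) x∈p⇔T[p[x]]

subsetOf : ∀ {ℓ} {P : Pred (Fin n) ℓ} → Decidable P → Subset n
subsetOf P? = tabulate (isYes ∘ P?)

∈-subsetOf : ∀ {ℓ} {P : Pred (Fin n) ℓ} (P? : Decidable P) {x} → x ∈ subsetOf P? ⇔ P x
∈-subsetOf P? {x} = mk⇔ (toWitness ∘ to (∈-tabulate (isYes ∘ P?)))
                         (from (∈-tabulate (isYes ∘ P?)) ∘ fromWitness)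

x∈p─q⇒x∉q : ∀ (p q : Subset n) {x} → x ∈ p ─ q → x ∉ q
x∈p─q⇒x∉q (inside ∷ p) (outside ∷ q) here ()
x∈p─q⇒x∉q (_ ∷ p) (_ ∷ q) (there x∈) (there x∈q) = x∈p─q⇒x∉q p q x∈ x∈q

x∈p─q⇔ : ∀ (p q : Subset n) {x} → x ∈ p ─ q ⇔ (x ∈ p × x ∉ q)
x∈p─q⇔ p q = mk⇔ (λ x∈ → p─q⊆p p q x∈ , x∈p─q⇒x∉q p q x∈)
                 (λ (x∈p , x∉q) → x∈p∧x∉q⇒x∈p─q x∈p x∉q)

∣p∣≡∣p∩q∣+∣p∩∁q∣ : ∀ (p q : Subset n) → ∣ p ∣ ≡ ∣ p ∩ q ∣ + ∣ p ∩ ∁ q ∣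
∣p∣≡∣p∩q∣+∣p∩∁q∣ []            []            = refl
∣p∣≡∣p∩q∣+∣p∩∁q∣ (outside ∷ p) (_       ∷ q) = ∣p∣≡∣p∩q∣+∣p∩∁q∣ p q
∣p∣≡∣p∩q∣+∣p∩∁q∣ (inside  ∷ p) (inside  ∷ q) = cong suc (∣p∣≡∣p∩q∣+∣p∩∁q∣ p q)
∣p∣≡∣p∩q∣+∣p∩∁q∣ (inside  ∷ p) (outside ∷ q) =
  trans (cong suc (∣p∣≡∣p∩q∣+∣p∩∁q∣ p q)) (sym (+-suc _ _))

empty⇒∣p∣≡0 : ∀ (p : Subset n) → (∀ {x} → x ∉ p) → ∣ p ∣ ≡ 0
empty⇒∣p∣≡0 {n} p x∉p =
  n≤0⇒n≡0 (≤-trans (p⊆q⇒∣p∣≤∣q∣ {p = p} {q = ⊥} (λ x∈p → contradiction x∈p x∉p)) (≤-reflexive (∣⊥∣≡0 n)))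

subsingleton⇒∣p∣≤1 : ∀ (p : Subset n) → (∀ {x y} → x ∈ p → y ∈ p → x ≡ y) → ∣ p ∣ ≤ 1
subsingleton⇒∣p∣≤1 []            _   = z≤n
subsingleton⇒∣p∣≤1 (outside ∷ p) eq =
  subsingleton⇒∣p∣≤1 p (λ x∈p y∈p → Fin-suc-injective (eq (there x∈p) (there y∈p)))
subsingleton⇒∣p∣≤1 (inside  ∷ p) eq =
  s≤s (≤-reflexive (empty⇒∣p∣≡0 p (λ x∈p → Fin-0≢1+n (eq here (there x∈p)))))

∣p∣≡∣q∣+∣r∣ : ∀ {p q r : Subset n} → (∀ {x} → x ∈ p ⇔ (x ∈ q ⊎ x ∈ r)) → (∀ {x} → x ∈ q → x ∉ r) →
              ∣ p ∣ ≡ ∣ q ∣ + ∣ r ∣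
∣p∣≡∣q∣+∣r∣ {p = p} {q} {r} p≡q⊎r q∩r≡∅ = begin
  ∣ p ∣                      ≡⟨ ∣p∣≡∣p∩q∣+∣p∩∁q∣ p q ⟩
  ∣ p ∩ q ∣ + ∣ p ∩ ∁ q ∣    ≡⟨ cong₂ (λ s t → ∣ s ∣ + ∣ t ∣) p∩q≡q p∩∁q≡r ⟩
  ∣ q ∣ + ∣ r ∣              ∎
  where
  open ≡-Reasoning
  p∩q≡q : p ∩ q ≡ q
  p∩q≡q = ⊆-antisym (proj₂ ∘ x∈p∩q⁻ p q) (λ x∈q → x∈p∩q⁺ (from p≡q⊎r (inj₁ x∈q) , x∈q))
  p∩∁q≡r : p ∩ ∁ q ≡ r
  p∩∁q≡r = ⊆-antisym
    (λ x∈ → let (x∈p , x∈∁q) = x∈p∩q⁻ p (∁ q) x∈ in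
      [ (λ x∈q → contradiction x∈q (x∈∁p⇒x∉p x∈∁q)) , (λ x∈r → x∈r) ]′ (to p≡q⊎r x∈p))
    (λ x∈r → x∈p∩q⁺ (from p≡q⊎r (inj₂ x∈r) , x∉p⇒x∈∁p (λ x∈q → q∩r≡∅ x∈q x∈r)))

injective⇒∣p∣≤ : ∀ B (p : Subset n) (g : Fin n → ℕ) → (∀ {x} → x ∈ p → g x < B) →
                 (∀ {x y} → x ∈ p → y ∈ p → g x ≡ g y → x ≡ y) → ∣ p ∣ ≤ B
injective⇒∣p∣≤ zero    p g bound _ = ≤-reflexive (empty⇒∣p∣≡0 p (λ x∈p → n≮0 (bound x∈p)))
injective⇒∣p∣≤ (suc B) p g bound inj = begin
  ∣ p ∣                     ≡⟨ ∣p∣≡∣p∩q∣+∣p∩∁q∣ p top ⟩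
  ∣ p ∩ top ∣ + ∣ p ∩ ∁ top ∣ ≤⟨ +-mono-≤ (subsingleton⇒∣p∣≤1 (p ∩ top) top-subsingleton)
                                           (injective⇒∣p∣≤ B (p ∩ ∁ top) g rest-bound rest-inj) ⟩
  1 + B                     ∎
  where
  open ≤-Reasoning
  top = subsetOf (λ x → g x ≟ B)
  top-subsingleton : ∀ {x y} → x ∈ p ∩ top → y ∈ p ∩ top → x ≡ y
  top-subsingleton x∈ y∈ with x∈p∩q⁻ p top x∈ | x∈p∩q⁻ p top y∈
  ... | x∈p , x∈top | y∈p , y∈top = inj x∈p y∈p
    (trans (to (∈-subsetOf _) x∈top) (sym (to (∈-subsetOf _) y∈top)))
  rest-bound : ∀ {x} → x ∈ p ∩ ∁ top → g x < B
  rest-bound x∈ with x∈p∩q⁻ p (∁ top) x∈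
  ... | x∈p , x∈∁top = ≤∧≢⇒< (≤-pred (bound x∈p))
                         (λ gx≡B → x∈∁p⇒x∉p x∈∁top (from (∈-subsetOf _) gx≡B))
  rest-inj : ∀ {x y} → x ∈ p ∩ ∁ top → y ∈ p ∩ ∁ top → g x ≡ g y → x ≡ y
  rest-inj x∈ y∈ = inj (proj₁ (x∈p∩q⁻ p (∁ top) x∈)) (proj₁ (x∈p∩q⁻ p (∁ top) y∈))

∑< : ℕ → (ℕ → ℕ) → ℕ
∑< zero    f = 0
∑< (suc B) f = ∑< B f + f B

∑<-mono-≤ : ∀ B {f g : ℕ → ℕ} → (∀ i → i < B → f i ≤ g i) → ∑< B f ≤ ∑< B g
∑<-mono-≤ zero    _   = z≤n
∑<-mono-≤ (suc B) f≤g = +-mono-≤ (∑<-mono-≤ B (λ i i<B → f≤g i (m<n⇒m<1+n i<B))) (f≤g B ≤-refl)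

∑<-cong : ∀ B {f g : ℕ → ℕ} → (∀ i → i < B → f i ≡ g i) → ∑< B f ≡ ∑< B g
∑<-cong B f≡g = ≤-antisym (∑<-mono-≤ B (λ i i<B → ≤-reflexive (f≡g i i<B)))
                          (∑<-mono-≤ B (λ i i<B → ≤-reflexive (sym (f≡g i i<B))))

+-mono-≤-≡⇒≡ : ∀ {a b c d} → a ≤ b → c ≤ d → a + c ≡ b + d → a ≡ b × c ≡ d
+-mono-≤-≡⇒≡ {a} {b} {c} {d} a≤b c≤d a+c≡b+d =
  a≡b , +-cancelˡ-≡ b c d (subst (λ x → x + c ≡ b + d) a≡b a+c≡b+d)
  where
  a≡b : a ≡ b
  a≡b = ≤-antisym a≤b (+-cancelʳ-≤ d b a (≤-trans (≤-reflexive (sym a+c≡b+d)) (+-monoʳ-≤ a c≤d)))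

∑<-mono-≤-≡⇒≡ : ∀ B {f g : ℕ → ℕ} → (∀ i → i < B → f i ≤ g i) → ∑< B f ≡ ∑< B g →
                ∀ i → i < B → f i ≡ g i
∑<-mono-≤-≡⇒≡ (suc B) f≤g ∑f≡∑g i i<1+B
  with +-mono-≤-≡⇒≡ (∑<-mono-≤ B (λ j j<B → f≤g j (m<n⇒m<1+n j<B))) (f≤g B ≤-refl) ∑f≡∑g
... | ∑<B-equal , fB≡gB with m≤n⇒m<n∨m≡n (≤-pred i<1+B)
...   | inj₁ i<B  = ∑<-mono-≤-≡⇒≡ B (λ j j<B → f≤g j (m<n⇒m<1+n j<B)) ∑<B-equal i i<B
...   | inj₂ refl = fB≡gB

∑<-fibres : (f : Fin n → ℕ) (F : ℕ → Subset n) → (∀ {i x} → x ∈ F i ⇔ f x ≡ i) →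
            ∀ B → ∑< B (λ i → ∣ F i ∣) ≡ ∣ subsetOf (λ x → f x <? B) ∣
∑<-fibres f F ∈F zero = sym (empty⇒∣p∣≡0 _ (λ x∈ → n≮0 (to (∈-subsetOf (λ x → f x <? 0)) x∈)))
∑<-fibres f F ∈F (suc B) = begin
  ∑< B (λ i → ∣ F i ∣) + ∣ F B ∣           ≡⟨ cong (_+ ∣ F B ∣) (∑<-fibres f F ∈F B) ⟩
  ∣ subsetOf (λ x → f x <? B) ∣ + ∣ F B ∣  ≡⟨ +-comm ∣ subsetOf (λ x → f x <? B) ∣ ∣ F B ∣ ⟩
  ∣ F B ∣ + ∣ subsetOf (λ x → f x <? B) ∣  ≡⟨ ∣p∣≡∣q∣+∣r∣ partition disjoint ⟨
  ∣ subsetOf (λ x → f x <? suc B) ∣        ∎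
  where
  open ≡-Reasoning
  partition : ∀ {x} → x ∈ subsetOf (λ x → f x <? suc B) ⇔ (x ∈ F B ⊎ x ∈ subsetOf (λ x → f x <? B))
  partition = mk⇔
    (λ x∈ → [ (λ fx<B → inj₂ (from (∈-subsetOf _) fx<B)) , (λ fx≡B → inj₁ (from ∈F fx≡B)) ]′
              (m≤n⇒m<n∨m≡n (≤-pred (to (∈-subsetOf _) x∈))))
    [ (λ x∈FB → from (∈-subsetOf _) (s≤s (≤-reflexive (to ∈F x∈FB))))
    , (λ x∈ → from (∈-subsetOf _) (m<n⇒m<1+n (to (∈-subsetOf _) x∈))) ]′
  disjoint : ∀ {x} → x ∈ F B → x ∉ subsetOf (λ x → f x <? B)
  disjoint x∈FB x∈ = <-irrefl (to ∈F x∈FB) (to (∈-subsetOf _) x∈)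

∑<-∸ : ∀ k → ∑< k (k ∸_) ≡ suc k C 2
∑<-∸ k = sym (triangle k)
  where
  open ≡-Reasoning
  open +-*-Solver
  shift : ∀ B k → B ≤ k → ∑< B (suc k ∸_) ≡ ∑< B (k ∸_) + B
  shift zero    k _   = refl
  shift (suc B) k B<k = begin
    ∑< B (suc k ∸_) + (suc k ∸ B)          ≡⟨ cong₂ _+_ (shift B k (<⇒≤ B<k)) (+-∸-assoc 1 (<⇒≤ B<k)) ⟩
    (∑< B (k ∸_) + B) + suc (k ∸ B)         ≡⟨ solve 3 (λ s b c → (s :+ b) :+ (con 1 :+ c)
                                                             := (s :+ c) :+ (con 1 :+ b))
                                                  refl (∑< B (k ∸_)) B (k ∸ B) ⟩
    (∑< B (k ∸_) + (k ∸ B)) + suc B         ∎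
  triangle : ∀ k → suc k C 2 ≡ ∑< k (k ∸_)
  triangle zero    = refl
  triangle (suc k) = begin
    suc (suc k) C 2                       ≡⟨ nCk+nC[k+1]≡[n+1]C[k+1] (suc k) 1 ⟨
    suc k C 1 + suc k C 2                 ≡⟨ cong₂ _+_ (nC1≡n (suc k)) (triangle k) ⟩
    suc k + ∑< k (k ∸_)                   ≡⟨ +-comm (suc k) _ ⟩
    ∑< k (k ∸_) + suc k                   ≡⟨ +-suc _ k ⟩
    suc (∑< k (k ∸_) + k)                 ≡⟨ cong suc (shift k k ≤-refl) ⟨
    suc (∑< k (suc k ∸_))                 ≡⟨ +-comm 1 _ ⟩
    ∑< k (suc k ∸_) + 1                   ≡⟨ cong (∑< k (suc k ∸_) +_) (m+n∸n≡m 1 k) ⟨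
    ∑< k (suc k ∸_) + (suc k ∸ k)         ∎

<∸⇔+< : ∀ a b k → b < k ∸ a ⇔ a + b < k
<∸⇔+< a b k = mk⇔
  (λ b<k∸a → subst (a + b <_) (m+[n∸m]≡n (a≤k b<k∸a)) (+-monoʳ-< a b<k∸a))
  (λ a+b<k → +-cancelˡ-< a b (k ∸ a)
               (subst (a + b <_) (sym (m+[n∸m]≡n (≤-trans (m≤m+n a b) (<⇒≤ a+b<k)))) a+b<k))
  where
  a≤k : b < k ∸ a → a ≤ k
  a≤k b<k∸a = <⇒≤ (m∸n≢0⇒n<m (m>n⇒m∸n≢0 (≤-trans (s≤s z≤n) b<k∸a)))

∈-leftOf : ∀ {n} {m p : Fin n} → p ∈ leftOf m ⇔ p F.< m
∈-leftOf {m = m} {p} = mk⇔ (≤ᵇ⇒≤ _ _ ∘ to (∈-tabulate _)) (from (∈-tabulate _) ∘ ≤⇒≤ᵇ)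

strictlyIncreasing⇒injective : ∀ {ℓ} {P : Pred (Fin n) ℓ} (g : Fin n → ℕ) →
                               (∀ {x y} → P x → P y → x F.< y → g x < g y) →
                               ∀ {x y} → P x → P y → g x ≡ g y → x ≡ y
strictlyIncreasing⇒injective g g-increasing {x} {y} px py gx≡gy with <-cmp (toℕ x) (toℕ y)
... | tri< x<y _ _ = contradiction gx≡gy (<⇒≢ (g-increasing px py x<y))
... | tri≈ _ x≡y _ = toℕ-injective x≡y
... | tri> _ _ y<x = contradiction (sym gx≡gy) (<⇒≢ (g-increasing py px y<x))

strictlyIncreasing⇒rank : ∀ {n K} (S : Subset n) (g : Fin n → ℕ) → ∣ S ∣ ≡ K → (∀ {x} → x ∈ S → g x < K) →
                          (∀ {x y} → x ∈ S → y ∈ S → x F.< y → g x < g y) →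
                          ∀ {m} → m ∈ S → ∣ S ∩ leftOf m ∣ ≡ g m
strictlyIncreasing⇒rank {n} {K} S g ∣S∣≡K g<K g-increasing {m} m∈S =
  proj₁ (+-mono-≤-≡⇒≡ left≤ right≤ (begin
    ∣ S ∩ leftOf m ∣ + ∣ S ∩ ∁ (leftOf m) ∣ ≡⟨ ∣p∣≡∣p∩q∣+∣p∩∁q∣ S (leftOf m) ⟨
    ∣ S ∣                                  ≡⟨ ∣S∣≡K ⟩
    K                                      ≡⟨ m+[n∸m]≡n (<⇒≤ (g<K m∈S)) ⟨
    g m + (K ∸ g m)                        ∎))
  where
  open ≡-Reasoning
  g-injective : ∀ {x y} → x ∈ S → y ∈ S → g x ≡ g y → x ≡ y
  g-injective = strictlyIncreasing⇒injective g g-increasing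
  right-of-m : ∀ {x} → x ∈ S ∩ ∁ (leftOf m) → x ∈ S × g m ≤ g x
  right-of-m {x} x∈ with x∈p∩q⁻ S _ x∈
  ... | x∈S , x∉left with <-cmp (toℕ m) (toℕ x)
  ...   | tri< m<x _ _ = x∈S , <⇒≤ (g-increasing m∈S x∈S m<x)
  ...   | tri≈ _ m≡x _ = x∈S , ≤-reflexive (cong g (toℕ-injective m≡x))
  ...   | tri> _ _ x<m = contradiction (from ∈-leftOf x<m) (x∈∁p⇒x∉p x∉left)
  left≤ : ∣ S ∩ leftOf m ∣ ≤ g m
  left≤ = injective⇒∣p∣≤ (g m) (S ∩ leftOf m) g
    (λ x∈ → let (x∈S , x<m) = x∈p∩q⁻ S _ x∈ in g-increasing x∈S m∈S (to ∈-leftOf x<m))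
    (λ x∈ y∈ → g-injective (proj₁ (x∈p∩q⁻ S _ x∈)) (proj₁ (x∈p∩q⁻ S _ y∈)))
  right≤ : ∣ S ∩ ∁ (leftOf m) ∣ ≤ K ∸ g m
  right≤ = injective⇒∣p∣≤ (K ∸ g m) (S ∩ ∁ (leftOf m)) (λ x → g x ∸ g m)
    (λ x∈ → let (x∈S , gm≤gx) = right-of-m x∈ in ∸-monoˡ-< (g<K x∈S) gm≤gx)
    (λ x∈ y∈ eq → let (x∈S , gm≤gx) = right-of-m x∈ ; (y∈S , gm≤gy) = right-of-m y∈
                  in g-injective x∈S y∈S (∸-cancelʳ-≡ gm≤gx gm≤gy eq))

opposite-< : ∀ {k} {i j : Fin k} → i F.< j → opposite j F.< opposite i
opposite-< {suc k} {i} {j} i<j =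
  subst₂ _<_ (sym (opposite-prop j)) (sym (opposite-prop i)) (∸-monoʳ-< i<j (≤-pred (toℕ<n j)))

module LongestChains {N : ℕ} (w : Fin N → ℕ) (_≺_ : ℕ → ℕ → Set)
                     (≺-trans : Transitive _≺_) (_≺?_ : B.Decidable _≺_) where

  Precedes : Fin N → Fin N → Set
  Precedes p q = p F.< q × w p ≺ w q

  precedes-trans : Transitive Precedes
  precedes-trans (p<q , wp≺wq) (q<r , wq≺wr) = <-trans p<q q<r , ≺-trans wp≺wq wq≺wr

  precedes? : B.Decidable Precedes
  precedes? p q = (toℕ p <? toℕ q) ×-dec (w p ≺? w q)

  data Chain : Fin N → ℕ → Set where
    start  : ∀ {m} → Chain m 0
    extend : ∀ {p m ℓ} → Precedes p m → Chain p ℓ → Chain m (suc ℓ)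

  Subsequence : Fin N → ℕ → Set
  Subsequence m ℓ = Σ (Fin (suc ℓ) → Fin N) λ idx →
    (∀ a b → a F.< b → idx a F.< idx b) ×
    (∀ a b → a F.< b → w (idx a) ≺ w (idx b)) ×
    idx (fromℕ ℓ) ≡ m

  fromEnd : ∀ {m ℓ} → Chain m ℓ → Fin (suc ℓ) → Fin N
  fromEnd {m} c            zero    = m
  fromEnd     (extend _ c) (suc j) = fromEnd c j

  fromEnd-precedes-end : ∀ {m ℓ} (c : Chain m ℓ) j → 0 < toℕ j → Precedes (fromEnd c j) m
  fromEnd-precedes-end (extend pr c) (suc zero)    _ = pr
  fromEnd-precedes-end (extend pr c) (suc (suc j)) _ =
    precedes-trans (fromEnd-precedes-end c (suc j) (s≤s z≤n)) pr

  fromEnd-precedes : ∀ {m ℓ} (c : Chain m ℓ) i j → toℕ i < toℕ j → Precedes (fromEnd c j) (fromEnd c i)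
  fromEnd-precedes c             zero    j       0<j       = fromEnd-precedes-end c j 0<j
  fromEnd-precedes (extend _ c) (suc i) (suc j) (s≤s i<j) = fromEnd-precedes c i j i<j

  chain⇒subsequence : ∀ {m ℓ} → Chain m ℓ → Subsequence m ℓ
  chain⇒subsequence {m} {ℓ} c =
    idx , (λ a b → proj₁ ∘ reversed a b) , (λ a b → proj₂ ∘ reversed a b) , ends
    where
    idx : Fin (suc ℓ) → Fin N
    idx a = fromEnd c (opposite a)
    reversed : ∀ a b → a F.< b → Precedes (idx a) (idx b)
    reversed a b a<b = fromEnd-precedes c (opposite b) (opposite a) (opposite-< a<b)
    opposite-last : opposite (fromℕ ℓ) ≡ zero
    opposite-last =
      toℕ-injective (trans (opposite-prop (fromℕ ℓ)) (trans (cong (ℓ ∸_) (toℕ-fromℕ ℓ)) (n∸n≡0 ℓ)))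
    ends : idx (fromℕ ℓ) ≡ m
    ends = cong (fromEnd c) opposite-last

  subsequence⇒chain : ∀ {m ℓ} → Subsequence m ℓ → Chain m ℓ
  subsequence⇒chain {ℓ = ℓ} (idx , idx-mono , w-mono , refl) = go ℓ idx idx-mono w-mono
    where
    go : ∀ ℓ (idx : Fin (suc ℓ) → Fin N) → (∀ a b → a F.< b → idx a F.< idx b) →
         (∀ a b → a F.< b → w (idx a) ≺ w (idx b)) → Chain (idx (fromℕ ℓ)) ℓ
    go zero    idx idx-mono w-mono = start
    go (suc ℓ) idx idx-mono w-mono =
      extend (idx-mono _ _ last<end , w-mono _ _ last<end)
             (go ℓ (idx ∘ inject₁) (λ a b → idx-mono _ _ ∘ inject₁-mono a b)
                                   (λ a b → w-mono _ _ ∘ inject₁-mono a b))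
      where
      inject₁-mono : ∀ (a b : Fin (suc ℓ)) → a F.< b → inject₁ a F.< inject₁ b
      inject₁-mono a b = subst₂ _<_ (sym (toℕ-inject₁ a)) (sym (toℕ-inject₁ b))
      last<end : inject₁ (fromℕ ℓ) F.< fromℕ (suc ℓ)
      last<end = subst₂ _<_ (sym (toℕ-inject₁ (fromℕ ℓ))) (sym (toℕ-fromℕ (suc ℓ)))
                            (≤-reflexive (cong suc (toℕ-fromℕ ℓ)))

  truncate : ∀ {m ℓ} → Chain m ℓ → ∀ {ℓ′} → ℓ′ ≤ ℓ → ∃ λ m′ → Chain m′ ℓ′
  truncate {m} start     z≤n = m , start
  truncate (extend pr c) ℓ′≤ℓ with m≤n⇒m<n∨m≡n ℓ′≤ℓ
  ... | inj₁ (s≤s ℓ′≤ℓ) = truncate c ℓ′≤ℓ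
  ... | inj₂ refl        = _ , extend pr c

  -- Chains ending at m pass only through positions below m, so fuel above toℕ m suffices.
  height       : ℕ → Fin N → ℕ
  heightThrough : ℕ → Fin N → Fin N → ℕ
  height zero       m = 0
  height (suc fuel) m = heightThrough fuel m (argmax (heightThrough fuel m) m (allFin N))
  heightThrough fuel m p with precedes? p m
  ... | yes _ = suc (height fuel p)
  ... | no  _ = 0

  height-chain : ∀ fuel m → Chain m (height fuel m)
  heightThrough-chain : ∀ fuel m p → Chain m (heightThrough fuel m p)
  height-chain zero       m = start
  height-chain (suc fuel) m = argmax-all (heightThrough fuel m) {xs = allFin N} (heightThrough-chain fuel m m)
                                (All.tabulate λ {p} _ → heightThrough-chain fuel m p)
  heightThrough-chain fuel m p with precedes? p m
  ... | yes pr = extend pr (height-chain fuel p)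
  ... | no  _  = start

  chain-≤-height : ∀ fuel {m ℓ} → toℕ m < fuel → Chain m ℓ → ℓ ≤ height fuel m
  chain-≤-height fuel       _    start = z≤n
  chain-≤-height (suc fuel) {m} m<fuel (extend {p} pr c) =
    ≤-trans (through pr c) (All.lookup (f[xs]≤f[argmax] m (allFin N)) (∈-allFin p))
    where
    through : ∀ {p ℓ} → Precedes p m → Chain p ℓ → suc ℓ ≤ heightThrough fuel m p
    through {p} pr c with precedes? p m
    ... | yes _  = s≤s (chain-≤-height fuel (≤-trans (proj₁ pr) (≤-pred m<fuel)) c)
    ... | no ¬pr = contradiction pr ¬pr

  longest : Fin N → ℕ
  longest = height N

  longest-chain : ∀ m → Chain m (longest m)
  longest-chain = height-chain N

  chain-≤-longest : ∀ {m ℓ} → Chain m ℓ → ℓ ≤ longest m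
  chain-≤-longest {m} = chain-≤-height N (toℕ<n m)

  precedes⇒longest< : ∀ {p q} → Precedes p q → longest p < longest q
  precedes⇒longest< pr = chain-≤-longest (extend pr (longest-chain _))

  <longest⇒predecessor : ∀ {m i} → i < longest m → ∃ λ p → Precedes p m × i ≤ longest p
  <longest⇒predecessor {m} i<longest with longest m | longest-chain m
  ... | suc _ | extend pr c = _ , pr , ≤-trans (≤-pred i<longest) (chain-≤-longest c)

  LongestEndingAtHasLength : Fin N → ℕ → Set
  LongestEndingAtHasLength m len =
    ∃ λ ℓ → len ≡ suc ℓ × Subsequence m ℓ × (∀ ℓ′ → Subsequence m ℓ′ → ℓ′ ≤ ℓ)

  longestEndingAtHasLength⇔ : ∀ {m len} → LongestEndingAtHasLength m len ⇔ len ≡ suc (longest m)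
  longestEndingAtHasLength⇔ {m} = mk⇔
    (λ { (ℓ , refl , s , maximal) → cong suc (≤-antisym (chain-≤-longest (subsequence⇒chain s))
                                                      (maximal _ (chain⇒subsequence (longest-chain m)))) })
    (λ { refl → longest m , refl , chain⇒subsequence (longest-chain m)
                , λ ℓ′ s → chain-≤-longest (subsequence⇒chain s) })

module _ {N : ℕ} (w : Vector ℕ N) where
  open LongestChains w _<_ <-trans _<?_

  chain⇒contains-id : ∀ {e ℓ} → Chain e ℓ → Contains w (id {suc ℓ})
  chain⇒contains-id c with chain⇒subsequence c
  ... | idx , idx-mono , w-mono , _ = idx , idx-mono , same-order
    where
    same-order : ∀ a b → (w (idx a) ≤ w (idx b)) ⇔ (word id a ≤ word id b)
    same-order a b with <-cmp (toℕ a) (toℕ b)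
    ... | tri< a<b _ _ = mk⇔ (λ _ → s≤s (<⇒≤ a<b)) (λ _ → <⇒≤ (w-mono a b a<b))
    ... | tri≈ _ a≡b _ rewrite toℕ-injective a≡b = mk⇔ (λ _ → ≤-refl) (λ _ → ≤-refl)
    ... | tri> _ _ b<a = mk⇔ (⊥-elim ∘ <⇒≱ (w-mono b a b<a)) (⊥-elim ∘ <⇒≱ b<a ∘ ≤-pred)

  contains-id⇒chain : ∀ {ℓ} → Contains w (id {suc ℓ}) → ∃ λ e → Chain e ℓ
  contains-id⇒chain {ℓ} (idx , idx-mono , same-order) =
    idx (fromℕ ℓ) , subsequence⇒chain (idx , idx-mono , w-mono , refl)
    where
    w-mono : ∀ a b → a F.< b → w (idx a) < w (idx b)
    w-mono a b a<b = ≰⇒> (λ wb≤wa → <⇒≱ a<b (≤-pred (to (same-order b a) wb≤wa)))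

module _ {n : ℕ} where

  leftPos rightPos : Fin n → Fin (n + n)
  leftPos  p = p ↑ˡ n
  rightPos q = n ↑ʳ opposite q

  data CopyOf : Fin (n + n) → Fin n → Set where
    leftCopy  : ∀ {q} → CopyOf (leftPos q) q
    rightCopy : ∀ {q} → CopyOf (rightPos q) q

  copyOf : ∀ e → ∃ (CopyOf e)
  copyOf e with splitAt n e in split≡
  ... | inj₁ p = p , subst (λ e → CopyOf e p) (splitAt⁻¹-↑ˡ split≡) leftCopy
  ... | inj₂ j = opposite j , subst (λ e → CopyOf e (opposite j))
                   (trans (cong (n ↑ʳ_) (opposite-involutive j)) (splitAt⁻¹-↑ʳ split≡)) rightCopy

  leftPos-<⇔ : ∀ {p p′} → leftPos p F.< leftPos p′ ⇔ p F.< p′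
  leftPos-<⇔ {p} {p′} = mk⇔ (subst₂ _<_ (toℕ-↑ˡ p n) (toℕ-↑ˡ p′ n))
                            (subst₂ _<_ (sym (toℕ-↑ˡ p n)) (sym (toℕ-↑ˡ p′ n)))

  rightPos-<⇔ : ∀ {q q′} → rightPos q′ F.< rightPos q ⇔ q F.< q′
  rightPos-<⇔ {q} {q′} = mk⇔
    (λ lt → subst₂ F._<_ (opposite-involutive q) (opposite-involutive q′)
              (opposite-< (+-cancelˡ-< n _ _
                (subst₂ _<_ (toℕ-↑ʳ n (opposite q′)) (toℕ-↑ʳ n (opposite q)) lt))))
    (λ q<q′ → subst₂ _<_ (sym (toℕ-↑ʳ n (opposite q′))) (sym (toℕ-↑ʳ n (opposite q)))
                (+-monoʳ-< n (opposite-< q<q′)))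

  leftPos<rightPos : ∀ p q → leftPos p F.< rightPos q
  leftPos<rightPos p q = subst₂ _<_ (sym (toℕ-↑ˡ p n)) (sym (toℕ-↑ʳ n (opposite q)))
                           (<-≤-trans (toℕ<n p) (m≤m+n n _))

  rightPos≮leftPos : ∀ p q → ¬ rightPos q F.< leftPos p
  rightPos≮leftPos p q = <-asym (leftPos<rightPos p q)

  copy<rightPos : ∀ {e p q} → CopyOf e q → p F.< q → e F.< rightPos p
  copy<rightPos {p = p} (leftCopy {q}) _   = leftPos<rightPos q p
  copy<rightPos          rightCopy     p<q = from rightPos-<⇔ p<q

module _ {n : ℕ} (π : Permutation′ n) where

  module Increasing = LongestChains (word π) _<_ <-trans _<?_
  module Decreasing = LongestChains (word π) (λ x y → y < x) (λ x<y y<z → <-trans y<z x<y) (λ x y → y <? x)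

  -- lis m = λ(m) − 1 and lds m = δ(m) − 1: chain lengths count steps, not entries.
  lis lds : Fin n → ℕ
  lis = Increasing.longest
  lds = Decreasing.longest

  word-injective : ∀ {p q} → word π p ≡ word π q → p ≡ q
  word-injective {p} {q} πp≡πq = begin
    p                       ≡⟨ inverseˡ π ⟨
    π ⟨$⟩ˡ (π ⟨$⟩ʳ p)       ≡⟨ cong (π ⟨$⟩ˡ_) (toℕ-injective (suc-injective πp≡πq)) ⟩
    π ⟨$⟩ˡ (π ⟨$⟩ʳ q)       ≡⟨ inverseˡ π ⟩
    q                       ∎
    where open ≡-Reasoning

  lds-increasing-on-level : ∀ {p q} → lis p ≡ lis q → p F.< q → lds p < lds q
  lds-increasing-on-level {p} {q} same-lis p<q with <-cmp (word π p) (word π q)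
  ... | tri< πp<πq _ _ = contradiction same-lis (<⇒≢ (Increasing.precedes⇒longest< (p<q , πp<πq)))
  ... | tri≈ _ πp≡πq _ = contradiction (cong toℕ (word-injective πp≡πq)) (<⇒≢ p<q)
  ... | tri> _ _ πp>πq = Decreasing.precedes⇒longest< (p<q , πp>πq)

  labels-injective : ∀ {p q} → lis p ≡ lis q → lds p ≡ lds q → p ≡ q
  labels-injective {q = q} same-lis =
    strictlyIncreasing⇒injective {P = λ x → lis x ≡ lis q} lds
      (λ x-level y-level → lds-increasing-on-level (trans x-level (sym y-level))) same-lis refl

  shadowsᵇ⇔precedes : ∀ {p q} → T (not (toℕ p ≡ᵇ toℕ q) ∧ inShadowOfᵇ π q p) ⇔ Increasing.Precedes p q
  shadowsᵇ⇔precedes {p} {q} = mk⇔ shadows⇒precedes precedes⇒shadows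
    where
    shadows⇒precedes : T (not (toℕ p ≡ᵇ toℕ q) ∧ inShadowOfᵇ π q p) → Increasing.Precedes p q
    shadows⇒precedes t with to T-∧ t
    ... | p≢q , shadow with to T-∧ shadow
    ... | p≤q , πp≤πq =
      ≤∧≢⇒< (≤ᵇ⇒≤ _ _ p≤q) p≢q′ , ≤∧≢⇒< (≤ᵇ⇒≤ _ _ πp≤πq) (p≢q′ ∘ cong toℕ ∘ word-injective)
      where p≢q′ = λ p≡q → to T-not p≢q (≡⇒≡ᵇ _ _ p≡q)
    precedes⇒shadows : Increasing.Precedes p q → T (not (toℕ p ≡ᵇ toℕ q) ∧ inShadowOfᵇ π q p)
    precedes⇒shadows (p<q , πp<πq) = from T-∧
      ( from T-not (<⇒≢ p<q ∘ ≡ᵇ⇒≡ _ _)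
      , from T-∧ (≤⇒≤ᵇ (<⇒≤ p<q) , ≤⇒≤ᵇ (<⇒≤ πp<πq)))

  ∈-firstLineOf : ∀ (R : Subset n) {q} →
                  q ∈ firstLineOf π R ⇔ (q ∈ R × ∀ {p} → p ∈ R → ¬ Increasing.Precedes p q)
  ∈-firstLineOf R {q} = mk⇔ onLine⇒ ⇒onLine
    where
    shadower : Fin n → Bool
    shadower p = lookup R p ∧ not (toℕ p ≡ᵇ toℕ q) ∧ inShadowOfᵇ π q p
    T-shadower : ∀ {p} → p ∈ R → Increasing.Precedes p q → T (shadower p)
    T-shadower p∈R pr = from T-∧ (to x∈p⇔T[p[x]] p∈R , from shadowsᵇ⇔precedes pr)
    onLine⇒ : q ∈ firstLineOf π R → q ∈ R × ∀ {p} → p ∈ R → ¬ Increasing.Precedes p q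
    onLine⇒ q∈ with to T-∧ (to (∈-tabulate _) q∈)
    ... | q∈R , unshadowed = from x∈p⇔T[p[x]] q∈R , λ {p} p∈R pr →
      to T-not unshadowed (any⁺ shadower (lose (∈-allFin p) (T-shadower p∈R pr)))
    ⇒onLine : q ∈ R × (∀ {p} → p ∈ R → ¬ Increasing.Precedes p q) → q ∈ firstLineOf π R
    ⇒onLine (q∈R , unshadowed) = from (∈-tabulate _) (from T-∧
      (to x∈p⇔T[p[x]] q∈R , from T-not λ t →
        let (p , shadows) = satisfied (any⁻ shadower (allFin n) t)
            (p∈R , rest)  = to T-∧ shadows
        in unshadowed (from x∈p⇔T[p[x]] p∈R) (to shadowsᵇ⇔precedes rest)))

  firstLineOf-level : ∀ {R : Subset n} {i} → (∀ {m} → m ∈ R ⇔ i ≤ lis m) →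
                      ∀ {q} → q ∈ firstLineOf π R ⇔ lis q ≡ i
  firstLineOf-level {R} {i} ∈R {q} = mk⇔ onLine⇒ ⇒onLine
    where
    onLine⇒ : q ∈ firstLineOf π R → lis q ≡ i
    onLine⇒ q∈ with to (∈-firstLineOf R) q∈
    ... | q∈R , unshadowed = sym (≤∧≮⇒≡ (to ∈R q∈R) λ i<lis →
      let (p , pr , i≤lis) = Increasing.<longest⇒predecessor i<lis
      in unshadowed (from ∈R i≤lis) pr)
    ⇒onLine : lis q ≡ i → q ∈ firstLineOf π R
    ⇒onLine refl = from (∈-firstLineOf R)
      (from ∈R ≤-refl , λ p∈R pr → <⇒≱ (Increasing.precedes⇒longest< pr) (to ∈R p∈R))

  ∈-remaining : ∀ i {m} → m ∈ remaining π i ⇔ i ≤ lis m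
  ∈-remaining zero    = mk⇔ (λ _ → z≤n) (λ _ → ∈⊤)
  ∈-remaining (suc i) {m} = mk⇔
    (λ m∈ → let (m∈R , m∉line) = to (x∈p─q⇔ R line) m∈
            in ≤∧≢⇒< (to (∈-remaining i) m∈R)
                     (m∉line ∘ from (firstLineOf-level (∈-remaining i)) ∘ sym))
    (λ i<lis → from (x∈p─q⇔ R line)
      (from (∈-remaining i) (<⇒≤ i<lis) ,
       <⇒≢ i<lis ∘ sym ∘ to (firstLineOf-level (∈-remaining i))))
    where
    R    = remaining π i
    line = firstLineOf π R

  ∈-shadowLine : ∀ i {m} → m ∈ shadowLine π (suc i) ⇔ lis m ≡ i
  ∈-shadowLine i = firstLineOf-level (∈-remaining i)

  concatRev-copy : ∀ {e q} → CopyOf e q → concatRev π e ≡ word π q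
  concatRev-copy (leftCopy {p})  rewrite splitAt-↑ˡ n p n = refl
  concatRev-copy (rightCopy {q}) rewrite splitAt-↑ʳ n n (opposite q) = cong (word π) (opposite-involutive q)

  module ConcatIncreasing = LongestChains (concatRev π) _<_ <-trans _<?_

  copy-< : ∀ {e e′ q q′} → CopyOf e q → CopyOf e′ q′ →
           concatRev π e < concatRev π e′ ⇔ word π q < word π q′
  copy-< e∼q e′∼q′ = mk⇔ (subst₂ _<_ (concatRev-copy e∼q) (concatRev-copy e′∼q′))
                         (subst₂ _<_ (sym (concatRev-copy e∼q)) (sym (concatRev-copy e′∼q′)))

  leftChain : ∀ {m ℓ} → Increasing.Chain m ℓ → ConcatIncreasing.Chain (leftPos m) ℓ
  leftChain Increasing.start                    = ConcatIncreasing.start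
  leftChain (Increasing.extend (p<m , πp<πm) c) =
    ConcatIncreasing.extend (from leftPos-<⇔ p<m , from (copy-< leftCopy leftCopy) πp<πm) (leftChain c)

  appendReversed : ∀ {e q ℓ s} → CopyOf e q → ConcatIncreasing.Chain e ℓ → Decreasing.Chain q s →
                   ∃ λ e′ → ConcatIncreasing.Chain e′ (ℓ + s)
  appendReversed {e} {ℓ = ℓ} _ c Decreasing.start =
    e , subst (ConcatIncreasing.Chain e) (sym (+-identityʳ ℓ)) c
  appendReversed {ℓ = ℓ} e∼q c (Decreasing.extend {p} {ℓ = s} (p<q , πq<πp) d)
    with appendReversed rightCopy
           (ConcatIncreasing.extend (copy<rightPos e∼q p<q , from (copy-< e∼q rightCopy) πq<πp) c) d
  ... | e′ , c′ = e′ , subst (ConcatIncreasing.Chain e′) (sym (+-suc ℓ s)) c′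

  concatChain : ∀ m → ∃ λ e → ConcatIncreasing.Chain e (lis m + lds m)
  concatChain m =
    appendReversed leftCopy (leftChain (Increasing.longest-chain m)) (Decreasing.longest-chain m)

  -- In π^r a chain can only go on through a
  -- decreasing subsequence of π ending at its current entry, read backwards; so a chain
  -- ending in the π^r half must stay bounded however it is continued that way.
  Reach : ∀ {e : Fin (n + n)} {q : Fin n} → CopyOf e q → ℕ → Set
  Reach (leftCopy {m})  ℓ = ℓ ≤ lis m
  Reach (rightCopy {q}) ℓ = ∀ {s} → Decreasing.Chain q s → ∃ λ m → ℓ + s ≤ lis m + lds m

  -- Either π_q extends the increasing run ending at π_m (m < q), or π_m extends the
  -- decreasing subsequence ending at π_q (q < m).
  increasing-then-larger : ∀ {m q ℓ s} → word π m < word π q → ℓ ≤ lis m → Decreasing.Chain q s →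
                           ∃ λ m′ → suc ℓ + s ≤ lis m′ + lds m′
  increasing-then-larger {m} {q} {ℓ} {s} πm<πq ℓ≤lis d with <-cmp (toℕ m) (toℕ q)
  ... | tri< m<q _ _ =
    q , +-mono-≤ (≤-<-trans ℓ≤lis (Increasing.precedes⇒longest< (m<q , πm<πq))) (Decreasing.chain-≤-longest d)
  ... | tri≈ _ m≡q _ = contradiction (cong (word π) (toℕ-injective m≡q)) (<⇒≢ πm<πq)
  ... | tri> _ _ q<m = m , subst (_≤ lis m + lds m) (+-suc ℓ s)
                             (+-mono-≤ ℓ≤lis (Decreasing.chain-≤-longest (Decreasing.extend (q<m , πm<πq) d)))

  reach-start : ∀ {e : Fin (n + n)} {q : Fin n} (e∼q : CopyOf e q) → Reach e∼q 0
  reach-start leftCopy          = z≤n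
  reach-start (rightCopy {q}) d = q , ≤-trans (Decreasing.chain-≤-longest d) (m≤n+m _ _)

  reach-extend : ∀ {e e′ : Fin (n + n)} {q q′ : Fin n} {ℓ} → ConcatIncreasing.Precedes e e′ →
                 (e∼q : CopyOf e q) (e′∼q′ : CopyOf e′ q′) → Reach e∼q ℓ → Reach e′∼q′ (suc ℓ)
  reach-extend (e<e′ , we<we′) leftCopy leftCopy ℓ≤lis =
    ≤-<-trans ℓ≤lis
      (Increasing.precedes⇒longest< (to leftPos-<⇔ e<e′ , to (copy-< leftCopy leftCopy) we<we′))
  reach-extend (e<e′ , _) (rightCopy {q}) (leftCopy {p}) _ = contradiction e<e′ (rightPos≮leftPos p q)
  reach-extend (_ , we<we′) leftCopy rightCopy ℓ≤lis =
    increasing-then-larger (to (copy-< leftCopy rightCopy) we<we′) ℓ≤lis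
  reach-extend {ℓ = ℓ} (e<e′ , we<we′) rightCopy rightCopy reach {s} d
    with reach (Decreasing.extend (to rightPos-<⇔ e<e′ , to (copy-< rightCopy rightCopy) we<we′) d)
  ... | m , bound = m , subst (_≤ lis m + lds m) (+-suc ℓ s) bound

  chain-reach : ∀ {e : Fin (n + n)} {q : Fin n} {ℓ} → ConcatIncreasing.Chain e ℓ →
                (e∼q : CopyOf e q) → Reach e∼q ℓ
  chain-reach ConcatIncreasing.start             e∼q = reach-start e∼q
  chain-reach (ConcatIncreasing.extend {p} pr c) e∼q =
    reach-extend pr (proj₂ (copyOf {n} p)) e∼q (chain-reach c (proj₂ (copyOf {n} p)))

  reach⇒bounded : ∀ {e : Fin (n + n)} {q : Fin n} {ℓ} (e∼q : CopyOf e q) → Reach e∼q ℓ →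
                  ∃ λ m → ℓ ≤ lis m + lds m
  reach⇒bounded (leftCopy {m}) ℓ≤lis = m , ≤-trans ℓ≤lis (m≤m+n _ _)
  reach⇒bounded rightCopy      reach with reach Decreasing.start
  ... | m , bound = m , subst (_≤ lis m + lds m) (+-identityʳ _) bound

  concatChain⇒bounded : ∀ {e ℓ} → ConcatIncreasing.Chain e ℓ → ∃ λ m → ℓ ≤ lis m + lds m
  concatChain⇒bounded {e} c = reach⇒bounded (proj₂ (copyOf {n} e)) (chain-reach c (proj₂ (copyOf {n} e)))

  avoids⇔bounded : ∀ k′ → Avoids (concatRev π) (id {suc k′}) ⇔ (∀ m → lis m + lds m < k′)
  avoids⇔bounded k′ = mk⇔
    (λ avoids m → ≰⇒> λ k′≤ →
      let (e , c) = concatChain m ; (_ , c′) = ConcatIncreasing.truncate c k′≤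
      in avoids (chain⇒contains-id (concatRev π) c′))
    (λ bounded contains →
      let (e , c) = contains-id⇒chain (concatRev π) contains ; (m , k′≤) = concatChain⇒bounded c
      in <⇒≱ (bounded m) k′≤)

  ShadowLineSizes : ℕ → Set
  ShadowLineSizes k′ = ∀ ℓ → ℓ < k′ → ∣ shadowLine π (suc ℓ) ∣ ≡ k′ ∸ ℓ

  LdsIsRankOnShadowLine : Set
  LdsIsRankOnShadowLine = ∀ m → lds m ≡ ∣ shadowLine π (suc (lis m)) ∩ leftOf m ∣

  ∑<-shadowLines : ∀ B → ∑< B (λ ℓ → ∣ shadowLine π (suc ℓ) ∣) ≡ ∣ subsetOf (λ m → lis m <? B) ∣
  ∑<-shadowLines = ∑<-fibres lis (λ ℓ → shadowLine π (suc ℓ)) (λ {ℓ} → ∈-shadowLine ℓ)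

  shadowLines-cover⇔lis< : ∀ B → ∑< B (λ ℓ → ∣ shadowLine π (suc ℓ) ∣) ≡ n ⇔ (∀ m → lis m < B)
  shadowLines-cover⇔lis< B = mk⇔
    (λ covered m → to (∈-subsetOf below?)
      (subst (m ∈_) (sym (∣p∣≡n⇒p≡⊤ (trans (sym (∑<-shadowLines B)) covered))) ∈⊤))
    (λ lis<B → begin
      ∑< B (λ ℓ → ∣ shadowLine π (suc ℓ) ∣) ≡⟨ ∑<-shadowLines B ⟩
      ∣ subsetOf below? ∣                    ≡⟨ cong ∣_∣ (⊆-antisym (λ _ → ∈⊤) (λ _ → from (∈-subsetOf below?) (lis<B _))) ⟩
      ∣ ⊤ {n} ∣                              ≡⟨ ∣⊤∣≡n n ⟩
      n                                      ∎)
    where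
    open ≡-Reasoning
    below? = λ m → lis m <? B

  same-shadowLine : ∀ ℓ {p q} → p ∈ shadowLine π (suc ℓ) → q ∈ shadowLine π (suc ℓ) → lis p ≡ lis q
  same-shadowLine ℓ p∈ q∈ = trans (to (∈-shadowLine ℓ) p∈) (sym (to (∈-shadowLine ℓ) q∈))

  module _ (k′ : ℕ) (n≡∑ : n ≡ ∑< k′ (k′ ∸_)) where

    module _ (bounded : ∀ m → lis m + lds m < k′) where

      lis<k′ : ∀ m → lis m < k′
      lis<k′ m = ≤-<-trans (m≤m+n _ _) (bounded m)

      lds<on-shadowLine : ∀ ℓ {m} → m ∈ shadowLine π (suc ℓ) → lds m < k′ ∸ ℓ
      lds<on-shadowLine ℓ {m} m∈ =
        subst (λ i → lds m < k′ ∸ i) (to (∈-shadowLine ℓ) m∈) (from (<∸⇔+< (lis m) (lds m) k′) (bounded m))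

      bounded⇒shadowLineSizes : ShadowLineSizes k′
      bounded⇒shadowLineSizes = ∑<-mono-≤-≡⇒≡ k′ (λ ℓ _ → line≤ ℓ) (begin
        ∑< k′ (λ ℓ → ∣ shadowLine π (suc ℓ) ∣) ≡⟨ from (shadowLines-cover⇔lis< k′) lis<k′ ⟩
        n                                      ≡⟨ n≡∑ ⟩
        ∑< k′ (k′ ∸_)                          ∎)
        where
        open ≡-Reasoning
        line≤ : ∀ ℓ → ∣ shadowLine π (suc ℓ) ∣ ≤ k′ ∸ ℓ
        line≤ ℓ = injective⇒∣p∣≤ (k′ ∸ ℓ) (shadowLine π (suc ℓ)) lds (lds<on-shadowLine ℓ)
                    (λ p∈ q∈ → labels-injective (same-shadowLine ℓ p∈ q∈))

      bounded⇒ldsIsRank : LdsIsRankOnShadowLine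
      bounded⇒ldsIsRank m = sym (strictlyIncreasing⇒rank (shadowLine π (suc (lis m))) lds
        (bounded⇒shadowLineSizes (lis m) (lis<k′ m))
        (lds<on-shadowLine (lis m))
        (λ p∈ q∈ → lds-increasing-on-level (same-shadowLine (lis m) p∈ q∈))
        (from (∈-shadowLine (lis m)) refl))

    sizes∧rank⇒bounded : ShadowLineSizes k′ → LdsIsRankOnShadowLine → ∀ m → lis m + lds m < k′
    sizes∧rank⇒bounded sizes rank m = to (<∸⇔+< (lis m) (lds m) k′) (begin-strict
      lds m                          ≡⟨ rank m ⟩
      ∣ line ∩ leftOf m ∣             ≤⟨ p⊆q⇒∣p∣≤∣q∣ left⊆line-m ⟩
      ∣ line - m ∣                   <⟨ x∈p⇒∣p-x∣<∣p∣ (from (∈-shadowLine (lis m)) refl) ⟩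
      ∣ line ∣                       ≡⟨ sizes (lis m) (to (shadowLines-cover⇔lis< k′) covered m) ⟩
      k′ ∸ lis m                     ∎)
      where
      open ≤-Reasoning
      covered : ∑< k′ (λ ℓ → ∣ shadowLine π (suc ℓ) ∣) ≡ n
      covered = trans (∑<-cong k′ sizes) (sym n≡∑)
      line = shadowLine π (suc (lis m))
      left⊆line-m : line ∩ leftOf m ⊆ line - m
      left⊆line-m p∈ = let (p∈line , p<m) = x∈p∩q⁻ line (leftOf m) p∈
                       in x∈p∧x≢y⇒x∈p-y p∈line (<⇒≢ (to ∈-leftOf p<m) ∘ cong toℕ)

    bounded⇔sizes×rank : (∀ m → lis m + lds m < k′) ⇔ (ShadowLineSizes k′ × LdsIsRankOnShadowLine)
    bounded⇔sizes×rank = mk⇔ (λ bounded → bounded⇒shadowLineSizes bounded , bounded⇒ldsIsRank bounded)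
                             (λ (sizes , rank) → sizes∧rank⇒bounded sizes rank)

  shadowLineSizes⇔ : ∀ k′ → (∀ (i : ℕ) → 1 ≤ i → i ≤ suc k′ ∸ 1 → ∣ shadowLine π i ∣ ≡ suc k′ ∸ i)
                            ⇔ ShadowLineSizes k′
  shadowLineSizes⇔ k′ = mk⇔ (λ sizes ℓ ℓ<k′ → sizes (suc ℓ) (s≤s z≤n) ℓ<k′)
                            (λ { sizes (suc ℓ) _ ℓ<k′ → sizes ℓ ℓ<k′ })

  JthPointsLabelled : Set
  JthPointsLabelled =
    ∀ (i j : ℕ) → 1 ≤ i → 1 ≤ j → ∀ (m : Fin n) → IsJthPoint (shadowLine π i) j m →
      (LongestIncEndingAtHasLength π m i × LongestDecEndingAtHasLength π m j ×
       (∀ (m′ : Fin n) → LongestIncEndingAtHasLength π m′ i → LongestDecEndingAtHasLength π m′ j → m′ ≡ m))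

  jthPointsLabelled⇔ldsIsRank : JthPointsLabelled ⇔ LdsIsRankOnShadowLine
  jthPointsLabelled⇔ldsIsRank = mk⇔ labelled⇒rank rank⇒labelled
    where
    labelled⇒rank : JthPointsLabelled → LdsIsRankOnShadowLine
    labelled⇒rank labelled m
      with labelled (suc (lis m)) _ (s≤s z≤n) (s≤s z≤n) m (from (∈-shadowLine (lis m)) refl , refl)
    ... | _ , ldsLength , _ = sym (suc-injective (to Decreasing.longestEndingAtHasLength⇔ ldsLength))
    rank⇒labelled : LdsIsRankOnShadowLine → JthPointsLabelled
    rank⇒labelled rank (suc ℓ) j _ _ m (m∈ , refl) =
      from Increasing.longestEndingAtHasLength⇔ (cong suc (sym lis≡ℓ)) ,
      from Decreasing.longestEndingAtHasLength⇔ j≡ ,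
      λ m′ lisLength ldsLength → labels-injective
        (suc-injective (trans (sym (to Increasing.longestEndingAtHasLength⇔ lisLength))
                              (cong suc (sym lis≡ℓ))))
        (suc-injective (trans (sym (to Decreasing.longestEndingAtHasLength⇔ ldsLength)) j≡))
      where
      lis≡ℓ : lis m ≡ ℓ
      lis≡ℓ = to (∈-shadowLine ℓ) m∈
      j≡ : suc ∣ shadowLine π (suc ℓ) ∩ leftOf m ∣ ≡ suc (lds m)
      j≡ = cong suc (trans (cong (λ i → ∣ shadowLine π (suc i) ∩ leftOf m ∣) (sym lis≡ℓ)) (sym (rank m)))

lemma5 : ∀ (k : ℕ) → 2 ≤ k → (π : Permutation′ (k C 2)) →
    Avoids (concatRev π) (id {k}) ⇔
    ((∀ (i : ℕ) → 1 ≤ i → i ≤ k ∸ 1 → ∣ shadowLine π i ∣ ≡ k ∸ i)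
    × (∀ (i j : ℕ) → 1 ≤ i → 1 ≤ j → ∀ (m : Fin (k C 2)) →
    IsJthPoint (shadowLine π i) j m →
    (LongestIncEndingAtHasLength π m i
    × LongestDecEndingAtHasLength π m j
    × (∀ (m′ : Fin (k C 2)) → LongestIncEndingAtHasLength π m′ i →
    LongestDecEndingAtHasLength π m′ j → m′ ≡ m))))
lemma5 (suc k′) (s≤s _) π =
  ⇔-trans (avoids⇔bounded π k′)
  (⇔-trans (bounded⇔sizes×rank π k′ (sym (∑<-∸ k′)))
           (⇔-sym (shadowLineSizes⇔ π k′ ×-⇔ jthPointsLabelled⇔ldsIsRank π)))
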